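{- For integers $c,d$ define $\chi(c,d)=1$ if there exists a matrix in $\mathrm{SL}_2(\mathbb{Z})$ with bottom row $(c,d)$ whose image in $\mathrm{PSL}_2(\mathbb{Z})$ lies in $G_1$, and $\chi(c,d)=0$ otherwise. Then for all integers $c,d$: (1) $\chi(c,d)=\chi(c,d+4c)$ and $\chi(c,d)=\chi(c+4d,d)$; (2) $\chi(c,d)=\chi(-c,-d)$; (3) $\chi(c,d)=\chi(d,d-c)$; (4) $\chi(c,d)=\chi(3c+2d,-5c-3d)$; (5) $\chi(c,d)=\chi(-c,d-c)$; (6) $\chi(c,d)=\chi(d,c)$.
   Context: Let $S,T\in\Gamma=\mathrm{PSL}_2(\mathbb{Z})$ be the images of $\begin{pmatrix}0&-1\\1&0\end{pmatrix}$ and $\begin{pmatrix}1&1\\0&1\end{pmatrix}$, and $R=ST$; $\Gamma$ is the free product of $\langle S\rangle\cong\mathbb{Z}/2$ and $\langle R\rangle\cong\mathbb{Z}/3$. Let $\phi_1\colon\Gamma\to S_7$ be the homomorphism with $\phi_1(S)=(12)(34)(56)$ and $\phi_1(R)=(235)(467)$ (permutations composed right to left), and $G_1=\phi_1^{ -1}(\mathrm{Stab}(1))$, a subgroup of index $7$. -}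

module Defs where

open import Data.Integer using (ℤ; +_; -_; _+_; _*_; _-_)
open import Data.Fin using (Fin; zero; suc)
open import Data.List using (List; []; _∷_)
open import Data.Product using (Σ; ∃; _×_; _,_)
open import Data.Sum using (_⊎_)
open import Relation.Binary.PropositionalEquality using (_≡_)
open import Function using (_∘_; id)

record Mat : Set where
  constructor mat
  field
    a b c d : ℤ

_·_ : Mat → Mat → Mat
mat a b c d · mat a' b' c' d' =
  mat (a * a' + b * c') (a * b' + b * d') (c * a' + d * c') (c * b' + d * d')

negM : Mat → Mat
negM (mat a b c d) = mat (- a) (- b) (- c) (- d)

I₂ : Mat
I₂ = mat (+ 1) (+ 0) (+ 0) (+ 1)

Smat Tmat Rmat : Mat
Smat = mat (+ 0) (- (+ 1)) (+ 1) (+ 0)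
Tmat = mat (+ 1) (+ 1) (+ 0) (+ 1)
Rmat = Smat · Tmat

-- Points 1..7 of S₇ are represented by Fin 7 (point k ↦ index k-1).
Perm7 : Set
Perm7 = Fin 7 → Fin 7

p1 p2 p3 p4 p5 p6 p7 : Fin 7
p1 = zero
p2 = suc zero
p3 = suc (suc zero)
p4 = suc (suc (suc zero))
p5 = suc (suc (suc (suc zero)))
p6 = suc (suc (suc (suc (suc zero))))
p7 = suc (suc (suc (suc (suc (suc zero)))))

-- φ₁(S) = (12)(34)(56)
σS : Perm7
σS zero = p2
σS (suc zero) = p1
σS (suc (suc zero)) = p4
σS (suc (suc (suc zero))) = p3
σS (suc (suc (suc (suc zero)))) = p6
σS (suc (suc (suc (suc (suc zero))))) = p5
σS (suc (suc (suc (suc (suc (suc zero)))))) = p7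

-- φ₁(R) = (235)(467) : 2→3→5→2, 4→6→7→4, 1 fixed
σR : Perm7
σR zero = p1
σR (suc zero) = p3
σR (suc (suc zero)) = p5
σR (suc (suc (suc zero))) = p6
σR (suc (suc (suc (suc zero)))) = p2
σR (suc (suc (suc (suc (suc zero))))) = p7
σR (suc (suc (suc (suc (suc (suc zero)))))) = p4

-- Generators S, R of Γ; since S⁻¹ = S and R⁻¹ = R², words in S, R
-- represent every element of Γ.
data Gen : Set where
  gS gR : Gen

genMat : Gen → Mat
genMat gS = Smat
genMat gR = Rmat

genPerm : Gen → Perm7
genPerm gS = σS
genPerm gR = σR

evalMat : List Gen → Mat
evalMat [] = I₂
evalMat (g ∷ w) = genMat g · evalMat w

evalPerm : List Gen → Perm7
evalPerm [] = id
evalPerm (g ∷ w) = genPerm g ∘ evalPerm w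

-- The image ±M in PSL₂(ℤ) of M lies in G₁ = φ₁⁻¹(Stab(1)):
-- some word in S, R represents ±M and its φ₁-image fixes the point 1.
InG1 : Mat → Set
InG1 M = Σ (List Gen) λ w →
  (evalMat w ≡ M ⊎ evalMat w ≡ negM M) × (evalPerm w p1 ≡ p1)

-- χ(c,d) = 1, as a proposition: there is a matrix (a b; c d) ∈ SL₂(ℤ)
-- whose image in PSL₂(ℤ) lies in G₁.
Chi : ℤ → ℤ → Set
Chi c d = Σ ℤ λ a → Σ ℤ λ b → (a * d - b * c ≡ + 1) × InG1 (mat a b c d)

{-# OPTIONS --safe #-}
module Submission where

-- Multiplying on the right by M ∈ G₁ ∩ SL₂(ℤ) preserves G₁ and moves the
-- bottom row to (c, d)M, so χ is invariant under this right action; this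
-- gives (1)–(4) for M = T⁴, U⁴ (U the lower unitriangular matrix), −I, R
-- and (TU)²S, since their φ₁-images fix 1. Conjugation by
-- K = (−1 −1; 0 1) ∈ GL₂(ℤ) induces an automorphism of Γ (S ↦ R²SR,
-- R ↦ R⁻¹) matching conjugation by τ = (25)(67) in S₇; as τ fixes 1 it
-- preserves G₁, and it sends the bottom row (c, d) to (−c, d − c), giving
-- (5). Finally (6) is the composite (c, d) ↦ (d, d − c) ↦ (−d, −c) ↦ (d, c)
-- of (3), (5) and (2).

open import Defs
open import Data.Integer using (ℤ; +_; -_; _+_; _*_; _-_)
open import Data.Product using (_×_)
open import Function.Bundles using (_⇔_)

open import Data.Fin using (zero; suc; _≟_)
open import Data.Fin.Properties using (all?)
open import Data.Integer.Properties using (neg-involutive)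
open import Data.Integer.Tactic.RingSolver using (solve)
open import Data.List using (List; []; _∷_; _++_; [_]; concatMap)
open import Data.Product using (_,_)
open import Data.Sum using (_⊎_; inj₁; inj₂)
open import Function.Bundles using (mk⇔; Equivalence)
open import Level using (0ℓ)
open import Relation.Binary.Bundles using (Setoid)
open import Relation.Binary.PropositionalEquality
  using (_≡_; refl; sym; trans; cong; cong₂; subst₂; module ≡-Reasoning)
import Relation.Binary.Reasoning.Setoid as SetoidReasoning
open import Relation.Nullary.Decidable using (from-yes)

det : Mat → ℤ
det (mat a b c d) = a * d - b * c

adj : Mat → Mat
adj (mat a b c d) = mat d (- b) (- c) a

mat-cong : ∀ {a b c d a′ b′ c′ d′} → a ≡ a′ → b ≡ b′ → c ≡ c′ → d ≡ d′ →
           mat a b c d ≡ mat a′ b′ c′ d′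
mat-cong refl refl refl refl = refl

·-identityˡ : ∀ X → I₂ · X ≡ X
·-identityˡ (mat a b c d) =
  mat-cong (solve (a ∷ c ∷ [])) (solve (b ∷ d ∷ [])) (solve (a ∷ c ∷ [])) (solve (b ∷ d ∷ []))

·-identityʳ : ∀ X → X · I₂ ≡ X
·-identityʳ (mat a b c d) =
  mat-cong (solve (a ∷ b ∷ [])) (solve (a ∷ b ∷ [])) (solve (c ∷ d ∷ [])) (solve (c ∷ d ∷ []))

·-assoc : ∀ X Y Z → X · (Y · Z) ≡ (X · Y) · Z
·-assoc (mat a b c d) (mat e f g h) (mat i j k l) =
  mat-cong (entry a b i k) (entry a b j l) (entry c d i k) (entry c d j l)
  where
  entry : ∀ x y z w →
    x * (e * z + f * w) + y * (g * z + h * w) ≡ (x * e + y * g) * z + (x * f + y * h) * w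
  entry x y z w = solve (x ∷ y ∷ z ∷ w ∷ e ∷ f ∷ g ∷ h ∷ [])

negM-involutive : ∀ X → negM (negM X) ≡ X
negM-involutive (mat a b c d) =
  mat-cong (neg-involutive a) (neg-involutive b) (neg-involutive c) (neg-involutive d)

negM-distribˡ-· : ∀ X Y → negM (X · Y) ≡ negM X · Y
negM-distribˡ-· (mat a b c d) (mat e f g h) =
  mat-cong (entry a b e g) (entry a b f h) (entry c d e g) (entry c d f h)
  where
  entry : ∀ x y z w → - (x * z + y * w) ≡ (- x) * z + (- y) * w
  entry x y z w = solve (x ∷ y ∷ z ∷ w ∷ [])

negM-distribʳ-· : ∀ X Y → negM (X · Y) ≡ X · negM Y
negM-distribʳ-· (mat a b c d) (mat e f g h) =
  mat-cong (entry a b e g) (entry a b f h) (entry c d e g) (entry c d f h)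
  where
  entry : ∀ x y z w → - (x * z + y * w) ≡ x * (- z) + y * (- w)
  entry x y z w = solve (x ∷ y ∷ z ∷ w ∷ [])

det-· : ∀ X Y → det (X · Y) ≡ det X * det Y
det-· (mat a b c d) (mat e f g h) = expand
  where
  expand : (a * e + b * g) * (c * f + d * h) - (a * f + b * h) * (c * e + d * g)
         ≡ (a * d - b * c) * (e * h - f * g)
  expand = solve (a ∷ b ∷ c ∷ d ∷ e ∷ f ∷ g ∷ h ∷ [])

det-adj : ∀ X → det (adj X) ≡ det X
det-adj (mat a b c d) = expand
  where
  expand : d * a - (- b) * (- c) ≡ a * d - b * c
  expand = solve (a ∷ b ∷ c ∷ d ∷ [])

·-adj : ∀ X → det X ≡ + 1 → X · adj X ≡ I₂
·-adj (mat a b c d) det≡1 =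
  mat-cong (trans diagonal det≡1) (offDiagonal a b) (offDiagonal′ c d) (trans diagonal′ det≡1)
  where
  offDiagonal : ∀ x y → x * (- y) + y * x ≡ + 0
  offDiagonal x y = solve (x ∷ y ∷ [])
  offDiagonal′ : ∀ x y → x * y + y * (- x) ≡ + 0
  offDiagonal′ x y = solve (x ∷ y ∷ [])
  diagonal : a * d + b * (- c) ≡ a * d - b * c
  diagonal = solve (a ∷ b ∷ c ∷ d ∷ [])
  diagonal′ : c * (- b) + d * a ≡ a * d - b * c
  diagonal′ = solve (a ∷ b ∷ c ∷ d ∷ [])

·-adj-cancelʳ : ∀ X M → det M ≡ + 1 → (X · M) · adj M ≡ X
·-adj-cancelʳ X M det≡1 = begin
  (X · M) · adj M   ≡⟨ sym (·-assoc X M (adj M)) ⟩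
  X · (M · adj M)   ≡⟨ cong (X ·_) (·-adj M det≡1) ⟩
  X · I₂            ≡⟨ ·-identityʳ X ⟩
  X                 ∎
  where open ≡-Reasoning

-- Equality in PSL₂(ℤ)

infix 4 _≈±_

_≈±_ : Mat → Mat → Set
X ≈± Y = X ≡ Y ⊎ X ≡ negM Y

≈±-sym : ∀ {X Y} → X ≈± Y → Y ≈± X
≈±-sym (inj₁ refl) = inj₁ refl
≈±-sym {Y = Y} (inj₂ refl) = inj₂ (sym (negM-involutive Y))

≈±-trans : ∀ {X Y Z} → X ≈± Y → Y ≈± Z → X ≈± Z
≈±-trans (inj₁ refl) q = q
≈±-trans (inj₂ refl) (inj₁ refl) = inj₂ refl
≈±-trans {Z = Z} (inj₂ refl) (inj₂ refl) = inj₁ (negM-involutive Z)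

≈±-setoid : Setoid 0ℓ 0ℓ
≈±-setoid = record
  { Carrier = Mat
  ; _≈_ = _≈±_
  ; isEquivalence = record { refl = inj₁ refl ; sym = ≈±-sym ; trans = ≈±-trans }
  }

module ≈±-Reasoning = SetoidReasoning ≈±-setoid

·-cong-≈± : ∀ {X X′ Y Y′} → X ≈± X′ → Y ≈± Y′ → X · Y ≈± X′ · Y′
·-cong-≈± (inj₁ refl) (inj₁ refl) = inj₁ refl
·-cong-≈± {X′ = X} {Y′ = Y} (inj₁ refl) (inj₂ refl) = inj₂ (sym (negM-distribʳ-· X Y))
·-cong-≈± {X′ = X} {Y′ = Y} (inj₂ refl) (inj₁ refl) = inj₂ (sym (negM-distribˡ-· X Y))
·-cong-≈± {X′ = X} {Y′ = Y} (inj₂ refl) (inj₂ refl) = inj₁ (begin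
  negM X · negM Y        ≡⟨ sym (negM-distribˡ-· X (negM Y)) ⟩
  negM (X · negM Y)      ≡⟨ cong negM (sym (negM-distribʳ-· X Y)) ⟩
  negM (negM (X · Y))    ≡⟨ negM-involutive (X · Y) ⟩
  X · Y                  ∎)
  where open ≡-Reasoning

·-congˡ-≈± : ∀ X {Y Y′} → Y ≈± Y′ → X · Y ≈± X · Y′
·-congˡ-≈± X = ·-cong-≈± {X} (inj₁ refl)

·-congʳ-≈± : ∀ Y {X X′} → X ≈± X′ → X · Y ≈± X′ · Y
·-congʳ-≈± Y X≈X′ = ·-cong-≈± {Y = Y} X≈X′ (inj₁ refl)

evalMat-++ : ∀ w v → evalMat (w ++ v) ≡ evalMat w · evalMat v
evalMat-++ [] v = sym (·-identityˡ (evalMat v))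
evalMat-++ (g ∷ w) v =
  trans (cong (genMat g ·_) (evalMat-++ w v)) (·-assoc (genMat g) (evalMat w) (evalMat v))

evalPerm-++ : ∀ w v x → evalPerm (w ++ v) x ≡ evalPerm w (evalPerm v x)
evalPerm-++ [] v x = refl
evalPerm-++ (g ∷ w) v x = cong (genPerm g) (evalPerm-++ w v x)

InG1-· : ∀ {X Y} → InG1 X → InG1 Y → InG1 (X · Y)
InG1-· (w , w≈X , w-fix) (v , v≈Y , v-fix) =
  w ++ v ,
  ≈±-trans (inj₁ (evalMat-++ w v)) (·-cong-≈± w≈X v≈Y) ,
  trans (evalPerm-++ w v p1) (trans (cong (evalPerm w) v-fix) w-fix)

genInv : Gen → List Gen
genInv gS = [ gS ]
genInv gR = gR ∷ gR ∷ []

word⁻¹ : List Gen → List Gen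
word⁻¹ [] = []
word⁻¹ (g ∷ w) = word⁻¹ w ++ genInv g

genInv-mat : ∀ g → evalMat (genInv g) · genMat g ≈± I₂
genInv-mat gS = inj₂ refl
genInv-mat gR = inj₂ refl

genInv-perm : ∀ g x → evalPerm (genInv g) (genPerm g x) ≡ x
genInv-perm gS = from-yes (all? λ x → evalPerm (genInv gS) (genPerm gS x) ≟ x)
genInv-perm gR = from-yes (all? λ x → evalPerm (genInv gR) (genPerm gR x) ≟ x)

word⁻¹-mat : ∀ w → evalMat (word⁻¹ w) · evalMat w ≈± I₂
word⁻¹-mat [] = inj₁ refl
word⁻¹-mat (g ∷ w) = begin
  evalMat (word⁻¹ w ++ genInv g) · (G · W)   ≡⟨ cong (_· (G · W)) (evalMat-++ (word⁻¹ w) (genInv g)) ⟩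
  (W⁻¹ · G⁻¹) · (G · W)                       ≡⟨ regroup ⟩
  W⁻¹ · ((G⁻¹ · G) · W)                       ≈⟨ ·-congˡ-≈± W⁻¹ (·-congʳ-≈± W (genInv-mat g)) ⟩
  W⁻¹ · (I₂ · W)                              ≡⟨ cong (W⁻¹ ·_) (·-identityˡ W) ⟩
  W⁻¹ · W                                     ≈⟨ word⁻¹-mat w ⟩
  I₂                                          ∎
  where
  open ≈±-Reasoning
  G = genMat g
  W = evalMat w
  G⁻¹ = evalMat (genInv g)
  W⁻¹ = evalMat (word⁻¹ w)
  regroup : (W⁻¹ · G⁻¹) · (G · W) ≡ W⁻¹ · ((G⁻¹ · G) · W)
  regroup = trans (sym (·-assoc W⁻¹ G⁻¹ (G · W))) (cong (W⁻¹ ·_) (·-assoc G⁻¹ G W))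

word⁻¹-perm : ∀ w x → evalPerm (word⁻¹ w) (evalPerm w x) ≡ x
word⁻¹-perm [] x = refl
word⁻¹-perm (g ∷ w) x =
  trans (evalPerm-++ (word⁻¹ w) (genInv g) (genPerm g (evalPerm w x)))
        (trans (cong (evalPerm (word⁻¹ w)) (genInv-perm g (evalPerm w x))) (word⁻¹-perm w x))

left-inverse⇒adj : ∀ {X M} → X · M ≈± I₂ → det M ≡ + 1 → X ≈± adj M
left-inverse⇒adj {X} {M} XM≈I det≡1 = begin
  X                  ≡⟨ sym (·-adj-cancelʳ X M det≡1) ⟩
  (X · M) · adj M    ≈⟨ ·-congʳ-≈± (adj M) XM≈I ⟩
  I₂ · adj M         ≡⟨ ·-identityˡ (adj M) ⟩
  adj M              ∎
  where open ≈±-Reasoning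

InG1-adj : ∀ {M} → InG1 M → det M ≡ + 1 → InG1 (adj M)
InG1-adj {M} (w , w≈M , w-fix) det≡1 =
  word⁻¹ w ,
  left-inverse⇒adj (≈±-trans (·-congˡ-≈± (evalMat (word⁻¹ w)) (≈±-sym w≈M)) (word⁻¹-mat w)) det≡1 ,
  trans (cong (evalPerm (word⁻¹ w)) (sym w-fix)) (word⁻¹-perm w p1)

K : Mat
K = mat (- + 1) (- + 1) (+ 0) (+ 1)

conjK : Mat → Mat
conjK X = (K · X) · K

K·K≡I₂ : K · K ≡ I₂
K·K≡I₂ = refl

conjK-· : ∀ X Y → conjK (X · Y) ≡ conjK X · conjK Y
conjK-· X Y = begin
  (K · (X · Y)) · K               ≡⟨ cong (_· K) (·-assoc K X Y) ⟩
  ((K · X) · Y) · K               ≡⟨ sym (·-assoc (K · X) Y K) ⟩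
  (K · X) · (Y · K)               ≡⟨ cong (λ Z → (K · X) · (Z · K)) (sym (·-identityˡ Y)) ⟩
  (K · X) · ((I₂ · Y) · K)        ≡⟨ cong (λ Z → (K · X) · ((Z · Y) · K)) (sym K·K≡I₂) ⟩
  (K · X) · (((K · K) · Y) · K)   ≡⟨ cong (λ Z → (K · X) · (Z · K)) (sym (·-assoc K K Y)) ⟩
  (K · X) · ((K · (K · Y)) · K)   ≡⟨ cong ((K · X) ·_) (sym (·-assoc K (K · Y) K)) ⟩
  (K · X) · (K · ((K · Y) · K))   ≡⟨ ·-assoc (K · X) K ((K · Y) · K) ⟩
  ((K · X) · K) · ((K · Y) · K)   ∎
  where open ≡-Reasoning

conjK-negM : ∀ X → conjK (negM X) ≡ negM (conjK X)
conjK-negM X = begin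
  (K · negM X) · K     ≡⟨ cong (_· K) (sym (negM-distribʳ-· K X)) ⟩
  negM (K · X) · K     ≡⟨ sym (negM-distribˡ-· (K · X) K) ⟩
  negM ((K · X) · K)   ∎
  where open ≡-Reasoning

conjK-≈± : ∀ {X Y} → X ≈± Y → conjK X ≈± conjK Y
conjK-≈± (inj₁ refl) = inj₁ refl
conjK-≈± {Y = Y} (inj₂ refl) = inj₂ (conjK-negM Y)

det-conjK : ∀ X → det (conjK X) ≡ det X
det-conjK X = begin
  det ((K · X) · K)         ≡⟨ det-· (K · X) K ⟩
  det (K · X) * det K       ≡⟨ cong (_* det K) (det-· K X) ⟩
  (det K * det X) * det K   ≡⟨ cancelSigns (det X) ⟩
  det X                     ∎
  where
  open ≡-Reasoning
  cancelSigns : ∀ x → (- + 1 * x) * - + 1 ≡ x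
  cancelSigns x = solve (x ∷ [])

conjK-gen : Gen → List Gen
conjK-gen gS = gR ∷ gR ∷ gS ∷ gR ∷ []
conjK-gen gR = gR ∷ gR ∷ []

conjK-gen-mat : ∀ g → evalMat (conjK-gen g) ≈± conjK (genMat g)
conjK-gen-mat gS = inj₁ refl
conjK-gen-mat gR = inj₂ refl

τ : Perm7
τ zero = p1
τ (suc zero) = p5
τ (suc (suc zero)) = p3
τ (suc (suc (suc zero))) = p4
τ (suc (suc (suc (suc zero)))) = p2
τ (suc (suc (suc (suc (suc zero))))) = p7
τ (suc (suc (suc (suc (suc (suc zero)))))) = p6

conjK-gen-perm : ∀ g x → evalPerm (conjK-gen g) (τ x) ≡ τ (genPerm g x)
conjK-gen-perm gS = from-yes (all? λ x → evalPerm (conjK-gen gS) (τ x) ≟ τ (genPerm gS x))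
conjK-gen-perm gR = from-yes (all? λ x → evalPerm (conjK-gen gR) (τ x) ≟ τ (genPerm gR x))

conjK-word-mat : ∀ w → evalMat (concatMap conjK-gen w) ≈± conjK (evalMat w)
conjK-word-mat [] = inj₁ refl
conjK-word-mat (g ∷ w) = begin
  evalMat (conjK-gen g ++ concatMap conjK-gen w)
    ≡⟨ evalMat-++ (conjK-gen g) (concatMap conjK-gen w) ⟩
  evalMat (conjK-gen g) · evalMat (concatMap conjK-gen w)
    ≈⟨ ·-cong-≈± (conjK-gen-mat g) (conjK-word-mat w) ⟩
  conjK (genMat g) · conjK (evalMat w)
    ≡⟨ sym (conjK-· (genMat g) (evalMat w)) ⟩
  conjK (genMat g · evalMat w)
    ∎
  where open ≈±-Reasoning

conjK-word-perm : ∀ w x → evalPerm (concatMap conjK-gen w) (τ x) ≡ τ (evalPerm w x)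
conjK-word-perm [] x = refl
conjK-word-perm (g ∷ w) x =
  trans (evalPerm-++ (conjK-gen g) (concatMap conjK-gen w) (τ x))
        (trans (cong (evalPerm (conjK-gen g)) (conjK-word-perm w x)) (conjK-gen-perm g (evalPerm w x)))

InG1-conjK : ∀ {M} → InG1 M → InG1 (conjK M)
InG1-conjK (w , w≈M , w-fix) =
  concatMap conjK-gen w ,
  ≈±-trans (conjK-word-mat w) (conjK-≈± w≈M) ,
  trans (conjK-word-perm w p1) (cong τ w-fix)

Chi-·ʳ : ∀ {A B C D c d} → InG1 (mat A B C D) → det (mat A B C D) ≡ + 1 →
         Chi c d → Chi (c * A + d * C) (c * B + d * D)
Chi-·ʳ {A} {B} {C} {D} {c} {d} M∈G₁ detM≡1 (a , b , det≡1 , X∈G₁) =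
  a * A + b * C , a * B + b * D ,
  trans (det-· (mat a b c d) (mat A B C D)) (cong₂ _*_ det≡1 detM≡1) ,
  InG1-· X∈G₁ M∈G₁

Chi-⇔-·ʳ : ∀ {A B C D c d c′ d′} → InG1 (mat A B C D) → det (mat A B C D) ≡ + 1 →
           c * A + d * C ≡ c′ → c * B + d * D ≡ d′ → Chi c d ⇔ Chi c′ d′
Chi-⇔-·ʳ {A} {B} {C} {D} {c} {d} M∈G₁ detM≡1 refl refl =
  mk⇔ (Chi-·ʳ M∈G₁ detM≡1)
      (λ h → subst₂ Chi (cong Mat.c cancel) (cong Mat.d cancel)
               (Chi-·ʳ (InG1-adj M∈G₁ detM≡1) (trans (det-adj (mat A B C D)) detM≡1) h))
  where
  -- Only bottom rows matter, so the top row of this matrix is arbitrary.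
  cancel : (mat (+ 0) (+ 0) c d · mat A B C D) · adj (mat A B C D) ≡ mat (+ 0) (+ 0) c d
  cancel = ·-adj-cancelʳ (mat (+ 0) (+ 0) c d) (mat A B C D) detM≡1

Chi-conjK : ∀ {c d} → Chi c d → Chi (- c) (d - c)
Chi-conjK {c} {d} (a , b , det≡1 , X∈G₁) =
  subst₂ Chi bottomLeft bottomRight
    (Mat.a X′ , Mat.b X′ , trans (det-conjK (mat a b c d)) det≡1 , InG1-conjK X∈G₁)
  where
  X′ = conjK (mat a b c d)
  bottomLeft : (+ 0 * a + + 1 * c) * - + 1 + (+ 0 * b + + 1 * d) * + 0 ≡ - c
  bottomLeft = solve (a ∷ b ∷ c ∷ d ∷ [])
  bottomRight : (+ 0 * a + + 1 * c) * - + 1 + (+ 0 * b + + 1 * d) * + 1 ≡ d - c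
  bottomRight = solve (a ∷ b ∷ c ∷ d ∷ [])

Chi-⇔-conjK : ∀ {c d} → Chi c d ⇔ Chi (- c) (d - c)
Chi-⇔-conjK {c} {d} =
  mk⇔ Chi-conjK (λ h → subst₂ Chi (neg-involutive c) shift (Chi-conjK h))
  where
  shift : (d - c) - (- c) ≡ d
  shift = solve (c ∷ d ∷ [])

-- T = −SR and U = −SR²; N = (TU)²S.
T-word U-word : List Gen
T-word = gS ∷ gR ∷ []
U-word = gS ∷ gR ∷ gR ∷ []

InG1-T⁴ : InG1 (mat (+ 1) (+ 4) (+ 0) (+ 1))
InG1-T⁴ = T-word ++ T-word ++ T-word ++ T-word , inj₁ refl , refl

InG1-U⁴ : InG1 (mat (+ 1) (+ 0) (+ 4) (+ 1))
InG1-U⁴ = U-word ++ U-word ++ U-word ++ U-word , inj₁ refl , refl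

InG1-negI : InG1 (mat (- + 1) (+ 0) (+ 0) (- + 1))
InG1-negI = [] , inj₂ refl , refl

InG1-R : InG1 (mat (+ 0) (- + 1) (+ 1) (+ 1))
InG1-R = [ gR ] , inj₁ refl , refl

InG1-N : InG1 (mat (+ 3) (- + 5) (+ 2) (- + 3))
InG1-N = T-word ++ U-word ++ T-word ++ U-word ++ [ gS ] , inj₁ refl , refl

Chi-⇔-T⁴ : ∀ {c d} → Chi c d ⇔ Chi c (d + + 4 * c)
Chi-⇔-T⁴ {c} {d} = Chi-⇔-·ʳ InG1-T⁴ refl left right
  where
  left : c * + 1 + d * + 0 ≡ c
  left = solve (c ∷ d ∷ [])
  right : c * + 4 + d * + 1 ≡ d + + 4 * c
  right = solve (c ∷ d ∷ [])

Chi-⇔-U⁴ : ∀ {c d} → Chi c d ⇔ Chi (c + + 4 * d) d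
Chi-⇔-U⁴ {c} {d} = Chi-⇔-·ʳ InG1-U⁴ refl left right
  where
  left : c * + 1 + d * + 4 ≡ c + + 4 * d
  left = solve (c ∷ d ∷ [])
  right : c * + 0 + d * + 1 ≡ d
  right = solve (c ∷ d ∷ [])

Chi-⇔-N : ∀ {c d} → Chi c d ⇔ Chi (+ 3 * c + + 2 * d) (- (+ 5 * c) - + 3 * d)
Chi-⇔-N {c} {d} = Chi-⇔-·ʳ InG1-N refl left right
  where
  left : c * + 3 + d * + 2 ≡ + 3 * c + + 2 * d
  left = solve (c ∷ d ∷ [])
  right : c * - + 5 + d * - + 3 ≡ - (+ 5 * c) - + 3 * d
  right = solve (c ∷ d ∷ [])

Chi-⇔-neg : ∀ {c d} → Chi c d ⇔ Chi (- c) (- d)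
Chi-⇔-neg {c} {d} = Chi-⇔-·ʳ InG1-negI refl left right
  where
  left : c * - + 1 + d * + 0 ≡ - c
  left = solve (c ∷ d ∷ [])
  right : c * + 0 + d * - + 1 ≡ - d
  right = solve (c ∷ d ∷ [])

Chi-⇔-R : ∀ {c d} → Chi c d ⇔ Chi d (d - c)
Chi-⇔-R {c} {d} = Chi-⇔-·ʳ InG1-R refl left right
  where
  left : c * + 0 + d * + 1 ≡ d
  left = solve (c ∷ d ∷ [])
  right : c * - + 1 + d * + 1 ≡ d - c
  right = solve (c ∷ d ∷ [])

Chi-swap : ∀ {c d} → Chi c d → Chi d c
Chi-swap {c} {d} h =
  subst₂ Chi (neg-involutive d) shift (Equivalence.to Chi-⇔-neg (Chi-conjK (Equivalence.to Chi-⇔-R h)))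
  where
  shift : - ((d - c) - d) ≡ c
  shift = solve (c ∷ d ∷ [])

proposition6p3 : (c d : ℤ) →
    ((Chi c d ⇔ Chi c (d + + 4 * c)) × (Chi c d ⇔ Chi (c + + 4 * d) d))
    × (Chi c d ⇔ Chi (- c) (- d))
    × (Chi c d ⇔ Chi d (d - c))
    × (Chi c d ⇔ Chi (+ 3 * c + + 2 * d) (- (+ 5 * c) - + 3 * d))
    × (Chi c d ⇔ Chi (- c) (d - c))
    × (Chi c d ⇔ Chi d c)
proposition6p3 c d =
    (Chi-⇔-T⁴ , Chi-⇔-U⁴)
  , Chi-⇔-neg
  , Chi-⇔-R
  , Chi-⇔-N
  , Chi-⇔-conjK
  , mk⇔ Chi-swap Chi-swap
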